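{- Let $n \geq 1$ and let $(\zeta_1, \dots, \zeta_n) \in \mathbb{G}_m^n(\overline{\mathbb{Q}})$ be a torsion point of order $N$. Then there exist a positive integer $e \leq N^{1-\frac{1}{2n}}$ dividing $N$, a primitive $N$-th root of unity $\zeta_N$, $e$-th roots of unity $\zeta_e^{(1)}, \dots, \zeta_e^{(n)}$, and integers $k_1, \dots, k_n$ with $|k_i| \leq N^{1-\frac{1}{2n}}/e$, such that $\zeta_i = \zeta_e^{(i)} \zeta_N^{k_i}$ for $i = 1, \dots, n$.
   Context: The order of a point of $\mathbb{G}_m^n$ is its order as an element of the group $\mathbb{G}_m^n(\overline{\mathbb{Q}}) = (\overline{\mathbb{Q}}^\times)^n$. -}

module Defs where

open import Data.Nat using (ℕ; suc; _≤_; _^_; _∸_) renaming (_*_ to _*ℕ_)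
open import Data.Integer using (ℤ; +_; ∣_∣)
open import Data.Rational using (ℚ; ↧ₙ_; _/_; _*_; _+_; _-_)
open import Data.Fin using (Fin)
open import Data.Product using (_×_)
open import Relation.Binary.PropositionalEquality using (_≡_)

-- Model of the torsion subgroup of  Q̄^×  (the group μ∞ of all roots of unity).
-- μ∞ ≅ ℚ/ℤ via  q ↦ exp(2πi q).  A root of unity is represented by an
-- exponent q : ℚ, and two exponents represent the same root of unity iff
-- their difference is an integer.  Multiplication of roots of unity is
-- addition of exponents and ζ^k corresponds to k * q.

IsInt : ℚ → Set
IsInt q = ↧ₙ q ≡ 1

_≈μ_ : ℚ → ℚ → Set
q ≈μ r = IsInt (q - r)

ℤ→ℚ : ℤ → ℚ
ℤ→ℚ k = k / 1

ℕ→ℚ : ℕ → ℚ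
ℕ→ℚ m = (+ m) / 1

_^μ_ : ℚ → ℤ → ℚ
q ^μ k = ℤ→ℚ k * q

_·μ_ : ℚ → ℚ → ℚ
q ·μ r = q + r

IsRootOfUnity : ℕ → ℚ → Set
IsRootOfUnity m q = IsInt (ℕ→ℚ m * q)

Kills : ∀ {n} → ℕ → (Fin n → ℚ) → Set
Kills m x = ∀ i → IsRootOfUnity m (x i)

HasOrder : ∀ {n} → (Fin n → ℚ) → ℕ → Set
HasOrder x N = 1 ≤ N × Kills N x × (∀ m → 1 ≤ m → Kills m x → N ≤ m)

-- order of a single root of unity; a primitive N-th root of unity has order N
HasOrder₁ : ℚ → ℕ → Set
HasOrder₁ z N = 1 ≤ N × IsRootOfUnity N z × (∀ m → 1 ≤ m → IsRootOfUnity m z → N ≤ m)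

-- a ≤ N^(1 - 1/(2n))  ⇔  a^(2n) ≤ N^(2n-1)   (for a, N ≥ 0, n ≥ 1)
≤Bound : ℕ → ℕ → ℕ → Set
≤Bound n N a = a ^ (2 *ℕ n) ≤ N ^ (2 *ℕ n ∸ 1)

{-# OPTIONS --safe #-}

-- Write xᵢ = aᵢ/N. By Dirichlet's box principle with about N^(1/2n) boxes per coordinate,
-- some 1 ≤ D ≤ N^(1-1/2n) has D·aᵢ = kᵢ + N·mᵢ with |kᵢ| ≤ N^(1-1/2n) (for N < 2^(2n) take
-- D = 1 and balanced residues). Let g = gcd(D, N), D = d·g and N = M·g. As d is a unit
-- modulo M, some c prime to N has c·d ≡ 1 (mod M), and ζ_N = exp(2πi c/N) is a primitive
-- N-th root of unity. Then k'ᵢ = d·aᵢ − M·mᵢ satisfies g·k'ᵢ = kᵢ and g·(aᵢ − c·k'ᵢ) ≡ 0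
-- (mod N), so ζᵢ·ζ_N^(−k'ᵢ) is a g-th root of unity and e = g does the job.

module Submission where

open import Defs
open import Data.Nat using (ℕ; _≤_; _*_)
open import Data.Nat.Divisibility using (_∣_)
open import Data.Integer using (ℤ; ∣_∣)
open import Data.Rational using (ℚ)
open import Data.Fin using (Fin)
open import Data.Product using (Σ; _×_)

open import Data.Nat.Base using (zero; suc; _+_; _^_; _∸_; _<_; _⊔_; z≤n; s≤s; s≤s⁻¹; s<s⁻¹; 2+;
  NonZero; >-nonZero; >-nonZero⁻¹; ≢-nonZero; ≢-nonZero⁻¹)
import Data.Nat.Properties as ℕ
open import Data.Nat.DivMod using (_/_; _%_; m/n*n≤m; m≡m%n+[m/n]*n; m%n<n; m<n*o⇒m/o<n; m/n<m; m<n⇒m%n≡m)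
open import Data.Nat.Divisibility using (divides; quotient; ∣⇒≤; ∣-trans; ∣-reflexive; ∣n⇒∣m*n; ∣m+n∣m⇒∣n; ∣1⇒≡1;
  *-pres-∣; quotient≢0; quotient-<; m∣n⇒n≡quotient*m)
open import Data.Nat.GCD using (gcd; gcd[m,n]∣m; gcd[m,n]∣n; gcd[m,n]≡0⇒m≡0; gcd[m,n]≢0; gcd-GCD; module Bézout)
open import Data.Nat.Coprimality using (Coprime; coprime-divisor; gcd≡1⇒coprime; coprime-Bézout; Bézout-coprime; 1-coprimeTo)
  renaming (sym to Coprime-sym)
open import Data.Nat.Induction using (<-wellFounded)
open import Data.Nat.Tactic.RingSolver using (solve-∀; solve)
open import Data.Integer.Base as ℤ using (+_; 0ℤ; 1ℤ; -1ℤ; _⊖_)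
import Data.Integer.Properties as ℤ
open import Data.Integer.DivMod using (_%ℕ_; _/ℕ_; n%ℕd<d; a≡a%ℕn+[a/ℕn]*n)
import Data.Integer.Divisibility.Signed as Signed
import Data.Integer.Tactic.RingSolver as ℤ-Solver
open import Data.Rational.Base as ℚ using (mkℚ)
import Data.Rational.Properties as ℚ
open import Data.Fin.Base using (zero; suc; toℕ; fromℕ<; funToFin; finToFun)
open import Data.Fin.Properties using (pigeonhole; toℕ-fromℕ<; toℕ<n; finToFun-funToFin)
open import Data.List.Base using (_∷_; [])
open import Data.Product using (_,_)
open import Data.Sum using (_⊎_; inj₁; inj₂)
open import Function.Base using (_∘_; case_of_)
open import Induction.WellFounded using (Acc; acc)
open import Relation.Nullary using (yes; no; contradiction)
open import Relation.Binary.PropositionalEquality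

^-distribʳ-* : ∀ m n k → (m * n) ^ k ≡ m ^ k * n ^ k
^-distribʳ-* m n zero    = refl
^-distribʳ-* m n (suc k) = begin
  m * n * (m * n) ^ k      ≡⟨ cong (m * n *_) (^-distribʳ-* m n k) ⟩
  m * n * (m ^ k * n ^ k)  ≡⟨ lemma m n (m ^ k) (n ^ k) ⟩
  m * m ^ k * (n * n ^ k)  ∎
  where
  open ≡-Reasoning
  lemma : ∀ a b x y → a * b * (x * y) ≡ a * x * (b * y)
  lemma = solve-∀

m<n^[1+p]⇒[m/n]^[1+p]≤m^p : ∀ m n p .{{_ : NonZero n}} → m < n ^ suc p → (m / n) ^ suc p ≤ m ^ p
m<n^[1+p]⇒[m/n]^[1+p]≤m^p zero    n@(suc _) p _     = z≤n
m<n^[1+p]⇒[m/n]^[1+p]≤m^p m@(suc _) n     p m<n^ = ℕ.*-cancelʳ-≤ _ _ m (begin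
  (m / n) ^ suc p * m             ≤⟨ ℕ.*-monoʳ-≤ ((m / n) ^ suc p) (ℕ.<⇒≤ m<n^) ⟩
  (m / n) ^ suc p * n ^ suc p     ≡⟨ ^-distribʳ-* (m / n) n (suc p) ⟨
  (m / n * n) ^ suc p             ≤⟨ ℕ.^-monoˡ-≤ (suc p) (m/n*n≤m m n) ⟩
  m * m ^ p                       ≡⟨ ℕ.*-comm m (m ^ p) ⟩
  m ^ p * m                       ∎)
  where open ℕ.≤-Reasoning

[1+t][1+X]≤1+t*t*X : ∀ t X → 2 ≤ t → t ≤ X → suc t * suc X ≤ suc (t * t * X)
[1+t][1+X]≤1+t*t*X t X 2≤t t≤X = begin
  suc t * suc X            ≡⟨ solve (t ∷ X ∷ []) ⟩
  suc (t * X + (X + t))    ≤⟨ s≤s (ℕ.+-monoʳ-≤ (t * X) (ℕ.+-monoʳ-≤ X t≤X)) ⟩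
  suc (t * X + (X + X))    ≡⟨ solve (t ∷ X ∷ []) ⟩
  suc (t * X + 2 * X)      ≤⟨ s≤s (ℕ.+-monoʳ-≤ (t * X) (ℕ.*-monoˡ-≤ X 2≤t)) ⟩
  suc (t * X + t * X)      ≡⟨ solve (t ∷ X ∷ []) ⟩
  suc (2 * t * X)          ≤⟨ s≤s (ℕ.*-monoˡ-≤ X (ℕ.*-monoˡ-≤ t 2≤t)) ⟩
  suc (t * t * X)          ∎
  where open ℕ.≤-Reasoning

[1+t]^[1+n]≤1+t^[1+2n] : ∀ t n → 2 ≤ t → suc t ^ suc n ≤ suc (t ^ suc (2 * n))
[1+t]^[1+n]≤1+t^[1+2n] t zero    _   = ℕ.≤-reflexive (cong (λ e → suc (t * e)) (ℕ.*-identityʳ 1))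
[1+t]^[1+n]≤1+t^[1+2n] t (suc n) 2≤t = begin
  suc t * suc t ^ suc n      ≤⟨ ℕ.*-monoʳ-≤ (suc t) ([1+t]^[1+n]≤1+t^[1+2n] t n 2≤t) ⟩
  suc t * suc X              ≤⟨ [1+t][1+X]≤1+t*t*X t X 2≤t t≤X ⟩
  suc (t * t * X)            ≡⟨ cong suc (ℕ.*-assoc t t X) ⟩
  suc (t * (t * X))          ≡⟨ cong (λ e → suc (t * (t * t ^ e))) (ℕ.+-suc n (n + 0)) ⟨
  suc (t ^ suc (2 * suc n))  ∎
  where
  open ℕ.≤-Reasoning
  X = t ^ suc (2 * n)
  t≤X : t ≤ X
  t≤X = ℕ.m≤m*n t (t ^ (2 * n)) {{ℕ.m^n≢0 t (2 * n) {{>-nonZero (ℕ.≤-trans (s≤s z≤n) 2≤t)}}}}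

root-bracket : ∀ N q → N < 2 ^ suc q ⊎ Σ ℕ λ t → 2 ≤ t × t ^ suc q ≤ N × N < suc t ^ suc q
root-bracket N q = search N N<[2+N]^[1+q]
  where
  N<[2+N]^[1+q] : N < suc (suc N) ^ suc q
  N<[2+N]^[1+q] = ℕ.<-≤-trans (s≤s (ℕ.n≤1+n N)) (ℕ.m≤m*n (suc (suc N)) (suc (suc N) ^ q) {{ℕ.m^n≢0 (suc (suc N)) q}})
  search : ∀ T → N < suc (suc T) ^ suc q → N < 2 ^ suc q ⊎ Σ ℕ λ t → 2 ≤ t × t ^ suc q ≤ N × N < suc t ^ suc q
  search zero    N<2^ = inj₁ N<2^
  search (suc T) N<   with suc (suc T) ^ suc q ℕ.≤? N
  ... | yes ≤N = inj₂ (suc (suc T) , s≤s (s≤s z≤n) , ≤N , N<)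
  ... | no  ≰N = search T (ℕ.≰⇒> ≰N)

-- Coprimality and units modulo N

coprime-∣ˡ : ∀ {a b d} → Coprime a b → d ∣ a → Coprime d b
coprime-∣ˡ a⊥b d∣a (e∣d , e∣b) = a⊥b (∣-trans e∣d d∣a , e∣b)

coprime-∣ʳ : ∀ {a b d} → Coprime a b → d ∣ b → Coprime a d
coprime-∣ʳ a⊥b d∣b (e∣a , e∣d) = a⊥b (e∣a , ∣-trans e∣d d∣b)

coprime-*ʳ : ∀ {a b c} → Coprime a b → Coprime a c → Coprime a (b * c)
coprime-*ʳ a⊥b a⊥c (d∣a , d∣bc) = a⊥c (d∣a , coprime-divisor (coprime-∣ˡ a⊥b d∣a) d∣bc)

coprime-^ʳ : ∀ {a b} k → Coprime a b → Coprime a (b ^ k)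
coprime-^ʳ zero    a⊥b (_ , d∣1) = ∣1⇒≡1 d∣1
coprime-^ʳ (suc k) a⊥b = coprime-*ʳ a⊥b (coprime-^ʳ k a⊥b)

CoprimePart : ℕ → ℕ → Set
CoprimePart c X = Σ ℕ λ r → Σ ℕ λ k → Coprime r c × X ∣ r * c ^ k

coprime-part : ∀ c X .{{_ : NonZero X}} → CoprimePart c X
coprime-part c X = go X (<-wellFounded X)
  where
  go : ∀ X .{{_ : NonZero X}} → Acc _<_ X → CoprimePart c X
  go X (acc rec) with gcd X c in g≡
  ... | zero     = contradiction (gcd[m,n]≡0⇒m≡0 g≡) (≢-nonZero⁻¹ X)
  ... | 1        = X , 0 , gcd≡1⇒coprime g≡ , ∣-reflexive (sym (ℕ.*-identityʳ X))
  ... | g@(2+ _) = extend (go (quotient g∣X) {{quotient≢0 g∣X}} (rec (quotient-< g∣X)))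
    where
    g∣X : g ∣ X
    g∣X = subst (_∣ X) g≡ (gcd[m,n]∣m X c)
    g∣c : g ∣ c
    g∣c = subst (_∣ c) g≡ (gcd[m,n]∣n X c)
    rearrange : ∀ r x c → r * x * c ≡ r * (c * x)
    rearrange = solve-∀
    extend : CoprimePart c (quotient g∣X) → CoprimePart c X
    extend (r , k , r⊥c , q∣rcᵏ) = r , suc k , r⊥c ,
      subst₂ _∣_ (sym (m∣n⇒n≡quotient*m g∣X)) (rearrange r (c ^ k) c) (*-pres-∣ q∣rcᵏ g∣c)

-- With N ∣ r·cᵏ and r ⊥ c, the number c + M·r is prime to r (as c is) and to c (as M·r is).
coprime-lift : ∀ {c M} N .{{_ : NonZero N}} → Coprime c M → Σ ℕ λ r → Coprime (c + M * r) N
coprime-lift {c} {M} N c⊥M with coprime-part c N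
... | r , k , r⊥c , N∣rcᵏ = r , coprime-∣ʳ (coprime-*ʳ u⊥r (coprime-^ʳ k u⊥c)) N∣rcᵏ
  where
  u = c + M * r
  ∣u∣Mr⇒∣c : ∀ {d} → d ∣ u → d ∣ M * r → d ∣ c
  ∣u∣Mr⇒∣c {d} d∣u d∣Mr = ∣m+n∣m⇒∣n (subst (d ∣_) (ℕ.+-comm c (M * r)) d∣u) d∣Mr
  u⊥r : Coprime u r
  u⊥r (d∣u , d∣r) = r⊥c (d∣r , ∣u∣Mr⇒∣c d∣u (∣n⇒∣m*n M d∣r))
  u⊥c : Coprime u c
  u⊥c (d∣u , d∣c) = r⊥c (d∣r , d∣c)
    where d∣r = coprime-divisor (coprime-∣ˡ c⊥M d∣c) (∣m+n∣m⇒∣n d∣u d∣c)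

inverse⇒coprime : ∀ {c d M S} → + c ℤ.* + d ≡ 1ℤ ℤ.+ + M ℤ.* S → Coprime c M
inverse⇒coprime {c} {d} {M} {S} cd≡1+MS {e} (e∣c , e∣M) = ∣1⇒≡1 (Signed.∣⇒∣ᵤ {+ e} {1ℤ} e∣1)
  where
  e∣1+MS : + e Signed.∣ 1ℤ ℤ.+ + M ℤ.* S
  e∣1+MS = subst (+ e Signed.∣_) cd≡1+MS (Signed.∣m⇒∣m*n (+ d) (Signed.∣ᵤ⇒∣ {+ e} {+ c} e∣c))
  e∣1 : + e Signed.∣ 1ℤ
  e∣1 = Signed.∣m+n∣n⇒∣m e∣1+MS (Signed.∣m⇒∣m*n S (Signed.∣ᵤ⇒∣ {+ e} {+ M} e∣M))

coprime⇒inverse : ∀ {d M} .{{_ : NonZero M}} → Coprime d M →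
  Σ ℕ λ c → Σ ℤ λ S → + c ℤ.* + d ≡ 1ℤ ℤ.+ + M ℤ.* S
coprime⇒inverse {d} {M} d⊥M with coprime-Bézout d⊥M
... | Bézout.+- x y 1+yM≡xd = x , + y , (begin
  + x ℤ.* + d          ≡⟨ ℤ.pos-* x d ⟨
  + (x * d)            ≡⟨ cong +_ 1+yM≡xd ⟨
  + (1 + y * M)        ≡⟨ cong (λ z → 1ℤ ℤ.+ z) (ℤ.pos-* y M) ⟩
  1ℤ ℤ.+ + y ℤ.* + M   ≡⟨ cong (λ z → 1ℤ ℤ.+ z) (ℤ.*-comm (+ y) (+ M)) ⟩
  1ℤ ℤ.+ + M ℤ.* + y   ∎)
  where open ≡-Reasoning
-- Here 1 + x·d = y·M, so (M − 1)·x inverts d modulo M.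
coprime⇒inverse {d} {suc m} d⊥M | Bézout.-+ x y 1+xd≡yM = m * x , + (m * y) ℤ.- 1ℤ , (begin
  + (m * x) ℤ.* + d                        ≡⟨ cong (ℤ._* + d) (ℤ.pos-* m x) ⟩
  + m ℤ.* + x ℤ.* + d                      ≡⟨ scale (+ m) (+ x) (+ d) (+ y) 1+xd≡yMℤ ⟩
  1ℤ ℤ.+ + suc m ℤ.* (+ m ℤ.* + y ℤ.- 1ℤ)  ≡⟨ cong (λ z → 1ℤ ℤ.+ + suc m ℤ.* (z ℤ.- 1ℤ)) (ℤ.pos-* m y) ⟨
  1ℤ ℤ.+ + suc m ℤ.* (+ (m * y) ℤ.- 1ℤ)    ∎)
  where
  open ≡-Reasoning
  1+xd≡yMℤ : 1ℤ ℤ.+ + x ℤ.* + d ≡ + y ℤ.* (1ℤ ℤ.+ + m)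
  1+xd≡yMℤ = begin
    1ℤ ℤ.+ + x ℤ.* + d   ≡⟨ cong (λ z → 1ℤ ℤ.+ z) (ℤ.pos-* x d) ⟨
    + (1 + x * d)        ≡⟨ cong +_ 1+xd≡yM ⟩
    + (y * suc m)        ≡⟨ ℤ.pos-* y (suc m) ⟩
    + y ℤ.* + suc m      ∎
  scale : ∀ m x d y → 1ℤ ℤ.+ x ℤ.* d ≡ y ℤ.* (1ℤ ℤ.+ m) →
          m ℤ.* x ℤ.* d ≡ 1ℤ ℤ.+ (1ℤ ℤ.+ m) ℤ.* (m ℤ.* y ℤ.- 1ℤ)
  scale m x d y 1+xd≡y[1+m] = begin
    m ℤ.* x ℤ.* d                        ≡⟨ ℤ-Solver.solve (m ∷ x ∷ d ∷ []) ⟩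
    m ℤ.* (1ℤ ℤ.+ x ℤ.* d) ℤ.- m         ≡⟨ cong (λ z → m ℤ.* z ℤ.- m) 1+xd≡y[1+m] ⟩
    m ℤ.* (y ℤ.* (1ℤ ℤ.+ m)) ℤ.- m       ≡⟨ ℤ-Solver.solve (m ∷ y ∷ []) ⟩
    1ℤ ℤ.+ (1ℤ ℤ.+ m) ℤ.* (m ℤ.* y ℤ.- 1ℤ) ∎

record UnitInverse (d M N : ℕ) : Set where
  field
    c        : ℕ
    S        : ℤ
    c⊥N      : Coprime c N
    cd≡1+MS  : + c ℤ.* + d ≡ 1ℤ ℤ.+ + M ℤ.* S

unit-inverse : ∀ {d M} N .{{_ : NonZero M}} .{{_ : NonZero N}} → Coprime d M → UnitInverse d M N
unit-inverse {d} {M} N d⊥M with coprime⇒inverse d⊥M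
... | c , S , cd≡1+MS with coprime-lift N (inverse⇒coprime {c} {d} {M} {S} cd≡1+MS)
...   | r , c+Mr⊥N = record
  { c       = c + M * r
  ; S       = S ℤ.+ + r ℤ.* + d
  ; c⊥N     = c+Mr⊥N
  ; cd≡1+MS = begin
      + (c + M * r) ℤ.* + d                 ≡⟨ cong (ℤ._* + d) (ℤ.pos-+ c (M * r)) ⟩
      (+ c ℤ.+ + (M * r)) ℤ.* + d           ≡⟨ cong (λ z → (+ c ℤ.+ z) ℤ.* + d) (ℤ.pos-* M r) ⟩
      (+ c ℤ.+ + M ℤ.* + r) ℤ.* + d         ≡⟨ shift (+ c) (+ d) (+ M) S (+ r) cd≡1+MS ⟩
      1ℤ ℤ.+ + M ℤ.* (S ℤ.+ + r ℤ.* + d)    ∎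
  }
  where
  open ≡-Reasoning
  shift : ∀ c d M S r → c ℤ.* d ≡ 1ℤ ℤ.+ M ℤ.* S → (c ℤ.+ M ℤ.* r) ℤ.* d ≡ 1ℤ ℤ.+ M ℤ.* (S ℤ.+ r ℤ.* d)
  shift c d M S r cd≡1+MS = begin
    (c ℤ.+ M ℤ.* r) ℤ.* d              ≡⟨ ℤ-Solver.solve (c ∷ d ∷ M ∷ r ∷ []) ⟩
    c ℤ.* d ℤ.+ M ℤ.* (r ℤ.* d)        ≡⟨ cong (λ z → z ℤ.+ M ℤ.* (r ℤ.* d)) cd≡1+MS ⟩
    1ℤ ℤ.+ M ℤ.* S ℤ.+ M ℤ.* (r ℤ.* d) ≡⟨ ℤ-Solver.solve (M ∷ S ∷ r ∷ d ∷ []) ⟩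
    1ℤ ℤ.+ M ℤ.* (S ℤ.+ r ℤ.* d)       ∎

-- Dirichlet's box principle

m<n*[1+m/n] : ∀ m n .{{_ : NonZero n}} → m < n * suc (m / n)
m<n*[1+m/n] m n = begin-strict
  m                  ≡⟨ m≡m%n+[m/n]*n m n ⟩
  m % n + m / n * n  <⟨ ℕ.+-monoˡ-< (m / n * n) (m%n<n m n) ⟩
  n + m / n * n      ≡⟨ cong (λ k → n + k) (ℕ.*-comm (m / n) n) ⟩
  n + n * (m / n)    ≡⟨ ℕ.*-suc n (m / n) ⟨
  n * suc (m / n)    ∎
  where open ℕ.≤-Reasoning

/-≡⇒∣-∣< : ∀ m n w .{{_ : NonZero w}} → m / w ≡ n / w → ∣ + m ℤ.- + n ∣ < w
/-≡⇒∣-∣< m n w m/w≡n/w = begin-strict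
  ∣ + m ℤ.- + n ∣
    ≡⟨ cong ∣_∣ (cong₂ (λ x y → + x ℤ.- + y) (m≡m%n+[m/n]*n m w) n≡n%w+[m/w]*w) ⟩
  ∣ + (m % w + m / w * w) ℤ.- + (n % w + m / w * w) ∣
    ≡⟨ cong ∣_∣ (cong₂ ℤ._-_ (ℤ.pos-+ (m % w) _) (ℤ.pos-+ (n % w) _)) ⟩
  ∣ (+ (m % w) ℤ.+ q) ℤ.- (+ (n % w) ℤ.+ q) ∣
    ≡⟨ cong ∣_∣ (cancel (+ (m % w)) (+ (n % w)) q) ⟩
  ∣ + (m % w) ℤ.- + (n % w) ∣
    ≡⟨ cong ∣_∣ (ℤ.m-n≡m⊖n (m % w) (n % w)) ⟩
  ∣ m % w ⊖ n % w ∣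
    ≤⟨ ℤ.∣m⊝n∣≤m⊔n (m % w) (n % w) ⟩
  m % w ⊔ n % w
    <⟨ ℕ.⊔-lub (m%n<n m w) (m%n<n n w) ⟩
  w ∎
  where
  open ℕ.≤-Reasoning
  q = + (m / w * w)
  n≡n%w+[m/w]*w : n ≡ n % w + m / w * w
  n≡n%w+[m/w]*w = trans (m≡m%n+[m/n]*n n w) (cong (λ k → n % w + k * w) (sym m/w≡n/w))
  cancel : ∀ x y q → (x ℤ.+ q) ℤ.- (y ℤ.+ q) ≡ x ℤ.- y
  cancel = ℤ-Solver.solve-∀

record Approximation {n} (N : ℕ) (a : Fin n → ℤ) (D : ℕ) (Small : ℕ → Set) : Set where
  field
    residue  : Fin n → ℤ
    multiple : Fin n → ℤ
    small    : ∀ i → Small ∣ residue i ∣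
    equation : ∀ i → + D ℤ.* a i ≡ residue i ℤ.+ + N ℤ.* multiple i

map-small : ∀ {n N D} {a : Fin n → ℤ} {P Q : ℕ → Set} → (∀ {k} → P k → Q k) →
  Approximation N a D P → Approximation N a D Q
map-small P⇒Q A = record { Approximation A ; small = λ i → P⇒Q (Approximation.small A i) }

module _ {n} (a : Fin (suc n) → ℤ) (N L : ℕ) .{{_ : NonZero N}} (2≤L : 2 ≤ L) where

  private
    instance
      L≢0 : NonZero L
      L≢0 = >-nonZero (ℕ.≤-trans (s≤s z≤n) 2≤L)

    w : ℕ
    w = suc (N / L)

    record Point : Set where
      field
        d        : ℕ
        d<Lⁿ     : d < L ^ suc n
        v        : Fin (suc n) → ℕ
        v≤N      : ∀ i → v i ≤ N
        m        : Fin (suc n) → ℤ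
        equation : ∀ i → + d ℤ.* a i ≡ + v i ℤ.+ + N ℤ.* m i
    open Point

    multiple-point : ∀ d → d < L ^ suc n → Point
    multiple-point d d<Lⁿ = record
      { d        = d
      ; d<Lⁿ     = d<Lⁿ
      ; v        = λ i → (+ d ℤ.* a i) %ℕ N
      ; v≤N      = λ i → ℕ.<⇒≤ (n%ℕd<d (+ d ℤ.* a i) N)
      ; m        = λ i → (+ d ℤ.* a i) /ℕ N
      ; equation = λ i → trans (a≡a%ℕn+[a/ℕn]*n (+ d ℤ.* a i) N)
                                 (cong (λ z → + ((+ d ℤ.* a i) %ℕ N) ℤ.+ z) (ℤ.*-comm _ (+ N)))
      }

    -- The extra pigeon that keeps D below Lⁿ: the point d = 0 with first residue N instead
    -- of 0. It never shares a box with the genuine d = 0 point, since w ≤ N.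
    corner : Point
    corner = record
      { d        = 0
      ; d<Lⁿ     = ℕ.m^n>0 L (suc n)
      ; v        = λ { zero → N ; (suc _) → 0 }
      ; v≤N      = λ { zero → ℕ.≤-refl ; (suc _) → z≤n }
      ; m        = λ { zero → -1ℤ ; (suc _) → 0ℤ }
      ; equation = λ { zero → wrap (a zero) (+ N) ; (suc i) → stay (a (suc i)) (+ N) }
      }
      where
      wrap : ∀ x y → 0ℤ ℤ.* x ≡ y ℤ.+ y ℤ.* -1ℤ
      wrap = ℤ-Solver.solve-∀
      stay : ∀ x y → 0ℤ ℤ.* x ≡ 0ℤ ℤ.+ y ℤ.* 0ℤ
      stay = ℤ-Solver.solve-∀

    cell : Point → Fin (suc n) → Fin L
    cell p i = fromℕ< (m<n*o⇒m/o<n {v p i} {L} {w} (ℕ.≤-<-trans (v≤N p i) (m<n*[1+m/n] N L)))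

    box : Point → Fin (L ^ suc n)
    box p = funToFin (cell p)

    box-coordinate : ∀ p i → toℕ (finToFun {L} (box p) i) ≡ v p i / w
    box-coordinate p i = trans (cong toℕ (finToFun-funToFin (cell p) i)) (toℕ-fromℕ< _)

    same-quotient : ∀ p q → box p ≡ box q → ∀ i → v p i / w ≡ v q i / w
    same-quotient p q same-box i =
      trans (sym (box-coordinate p i)) (trans (cong (λ b → toℕ (finToFun {L} b i)) same-box) (box-coordinate q i))

    Result : Set
    Result = Σ ℕ λ D → 1 ≤ D × D < L ^ suc n × Approximation N a D (_≤ N / L)

    difference : ∀ p q → d p < d q → box p ≡ box q → Result
    difference p q dp<dq same-box = d q ∸ d p , ℕ.m<n⇒0<n∸m dp<dq , ℕ.≤-<-trans (ℕ.m∸n≤m (d q) (d p)) (d<Lⁿ q) , record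
      { residue  = λ i → + v q i ℤ.- + v p i
      ; multiple = λ i → m q i ℤ.- m p i
      ; small    = λ i → s≤s⁻¹ (/-≡⇒∣-∣< (v q i) (v p i) w (sym (same-quotient p q same-box i)))
      ; equation = λ i → begin
          + (d q ∸ d p) ℤ.* a i               ≡⟨ cong (ℤ._* a i) D≡dq-dp ⟩
          (+ d q ℤ.- + d p) ℤ.* a i           ≡⟨ subtract (+ d q) (+ d p) (a i) (+ v q i) (+ v p i) (+ N) (m q i) (m p i)
                                                           (equation q i) (equation p i) ⟩
          (+ v q i ℤ.- + v p i) ℤ.+ + N ℤ.* (m q i ℤ.- m p i) ∎
      }
      where
      open ≡-Reasoning
      D≡dq-dp : + (d q ∸ d p) ≡ + d q ℤ.- + d p
      D≡dq-dp = trans (sym (ℤ.⊖-≥ (ℕ.<⇒≤ dp<dq))) (sym (ℤ.m-n≡m⊖n (d q) (d p)))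
      subtract : ∀ x y c vx vy N mx my → x ℤ.* c ≡ vx ℤ.+ N ℤ.* mx → y ℤ.* c ≡ vy ℤ.+ N ℤ.* my →
                 (x ℤ.- y) ℤ.* c ≡ (vx ℤ.- vy) ℤ.+ N ℤ.* (mx ℤ.- my)
      subtract x y c vx vy N mx my xc≡ yc≡ = begin
        (x ℤ.- y) ℤ.* c                            ≡⟨ ℤ-Solver.solve (x ∷ y ∷ c ∷ []) ⟩
        x ℤ.* c ℤ.- y ℤ.* c                        ≡⟨ cong₂ ℤ._-_ xc≡ yc≡ ⟩
        (vx ℤ.+ N ℤ.* mx) ℤ.- (vy ℤ.+ N ℤ.* my)    ≡⟨ ℤ-Solver.solve (vx ∷ vy ∷ N ∷ mx ∷ my ∷ []) ⟩
        (vx ℤ.- vy) ℤ.+ N ℤ.* (mx ℤ.- my)          ∎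

    point : Fin (suc (L ^ suc n)) → Point
    point zero    = corner
    point (suc j) = multiple-point (toℕ j) (toℕ<n j)

    corner-collision : ∀ d (d<Lⁿ : d < L ^ suc n) → box corner ≡ box (multiple-point d d<Lⁿ) → Result
    corner-collision zero    d<Lⁿ same-box = contradiction (ℕ.<-≤-trans N<w (m/n<m N L 2≤L)) (ℕ.<-irrefl refl)
      where
      N/w≡0/w : N / w ≡ 0 / w
      N/w≡0/w = trans (same-quotient corner (multiple-point 0 d<Lⁿ) same-box zero)
                      (cong (_/ w) (m<n⇒m%n≡m {m = 0} (>-nonZero⁻¹ N)))
      N<w : N < w
      N<w = subst (_< w) (ℕ.+-identityʳ N) (/-≡⇒∣-∣< N 0 w N/w≡0/w)
    corner-collision (suc d) d<Lⁿ same-box = difference corner (multiple-point (suc d) d<Lⁿ) (s≤s z≤n) same-box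

  dirichlet : Σ ℕ λ D → 1 ≤ D × D < L ^ suc n × Approximation N a D (_≤ N / L)
  dirichlet with pigeonhole (ℕ.n<1+n (L ^ suc n)) (box ∘ point)
  ... | zero  , suc j , _   , same-box = corner-collision (toℕ j) (toℕ<n j) same-box
  ... | suc i , suc j , i<j , same-box = difference (point (suc i)) (point (suc j)) (s<s⁻¹ i<j) same-box

balanced-approximation : ∀ {n} (a : Fin n → ℤ) N .{{_ : NonZero N}} → Approximation N a 1 (_≤ N / 2)
balanced-approximation a N = record
  { residue  = λ i → residue (single i) zero
  ; multiple = λ i → multiple (single i) zero
  ; small    = λ i → small (single i) zero
  ; equation = λ i → equation (single i) zero
  }
  where
  open Approximation
  -- Dirichlet with a single number and two boxes: 1 ≤ D < 2 forces D = 1.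
  single : ∀ i → Approximation N (λ (_ : Fin 1) → a i) 1 (_≤ N / 2)
  single i with dirichlet {0} (λ _ → a i) N 2 ℕ.≤-refl
  ... | 1 , _ , _ , A = A
  ... | 2+ _ , _ , s≤s (s≤s ()) , _

≤Bound-1 : ∀ n N .{{_ : NonZero N}} → ≤Bound n N 1
≤Bound-1 n N = subst (_≤ N ^ (2 * n ∸ 1)) (sym (ℕ.^-zeroˡ (2 * n))) (ℕ.m^n>0 N (2 * n ∸ 1))

≤Bound-mono : ∀ n N {a b} → a ≤ b → ≤Bound n N b → ≤Bound n N a
≤Bound-mono n N a≤b = ℕ.≤-trans (ℕ.^-monoˡ-≤ (2 * n) a≤b)

≤Bound-/ : ∀ n N L {k} .{{_ : NonZero L}} → N < L ^ (2 * suc n) → k ≤ N / L → ≤Bound (suc n) N k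
≤Bound-/ n N L N<Lᵖ k≤N/L = ≤Bound-mono (suc n) N k≤N/L (m<n^[1+p]⇒[m/n]^[1+p]≤m^p N L (2 * suc n ∸ 1) N<Lᵖ)

≤Bound-[1+t]ⁿ : ∀ n N t D → 2 ≤ t → t ^ (2 * suc n) ≤ N → D < suc t ^ suc n → ≤Bound (suc n) N D
≤Bound-[1+t]ⁿ n N t D 2≤t tᵖ≤N D<[1+t]ⁿ = ≤Bound-mono (suc n) N D≤tᴾ (begin
  (t ^ P) ^ (2 * suc n)   ≡⟨ ℕ.^-*-assoc t P (2 * suc n) ⟩
  t ^ (P * (2 * suc n))   ≡⟨ cong (t ^_) (ℕ.*-comm P (2 * suc n)) ⟩
  t ^ (2 * suc n * P)     ≡⟨ ℕ.^-*-assoc t (2 * suc n) P ⟨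
  (t ^ (2 * suc n)) ^ P   ≤⟨ ℕ.^-monoˡ-≤ P tᵖ≤N ⟩
  N ^ P                   ∎)
  where
  open ℕ.≤-Reasoning
  P = 2 * suc n ∸ 1
  [1+t]ⁿ≤1+tᴾ : suc t ^ suc n ≤ suc (t ^ P)
  [1+t]ⁿ≤1+tᴾ = subst (λ e → suc t ^ suc n ≤ suc (t ^ e)) (sym (ℕ.+-suc n (n + 0))) ([1+t]^[1+n]≤1+t^[1+2n] t n 2≤t)
  D≤tᴾ : D ≤ t ^ P
  D≤tᴾ = s≤s⁻¹ (ℕ.<-≤-trans D<[1+t]ⁿ [1+t]ⁿ≤1+tᴾ)

approximation : ∀ {n} (a : Fin (suc n) → ℤ) N .{{_ : NonZero N}} →
  Σ ℕ λ D → 1 ≤ D × ≤Bound (suc n) N D × Approximation N a D (≤Bound (suc n) N)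
approximation {n} a N with root-bracket N (2 * suc n ∸ 1)
... | inj₁ N<2ᵖ = 1 , s≤s z≤n , ≤Bound-1 (suc n) N , map-small (≤Bound-/ n N 2 N<2ᵖ) (balanced-approximation a N)
... | inj₂ (t , 2≤t , tᵖ≤N , N<[1+t]ᵖ) with dirichlet a N (suc t) (ℕ.m≤n⇒m≤1+n 2≤t)
...   | D , 1≤D , D<[1+t]ⁿ , A = D , 1≤D , ≤Bound-[1+t]ⁿ n N t D 2≤t tᵖ≤N D<[1+t]ⁿ ,
        map-small (≤Bound-/ n N (suc t) N<[1+t]ᵖ) A

-- Roots of unity as fractions z/N

ℤ→ℚ≡mkℚ : ∀ z → ℤ→ℚ z ≡ mkℚ z 0 (Coprime-sym (1-coprimeTo ∣ z ∣))
ℤ→ℚ≡mkℚ z = ℚ.↥p/↧p≡p (mkℚ z 0 _)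

ℤ→ℚ-+ : ∀ y z → ℤ→ℚ (y ℤ.+ z) ≡ ℤ→ℚ y ℚ.+ ℤ→ℚ z
ℤ→ℚ-+ y z rewrite ℤ→ℚ≡mkℚ y | ℤ→ℚ≡mkℚ z = ℚ./-cong (sym (cong₂ ℤ._+_ (ℤ.*-identityʳ y) (ℤ.*-identityʳ z))) refl

ℤ→ℚ-* : ∀ y z → ℤ→ℚ (y ℤ.* z) ≡ ℤ→ℚ y ℚ.* ℤ→ℚ z
ℤ→ℚ-* y z rewrite ℤ→ℚ≡mkℚ y | ℤ→ℚ≡mkℚ z = refl

ℤ→ℚ-neg : ∀ z → ℤ→ℚ (ℤ.- z) ≡ ℚ.- ℤ→ℚ z
ℤ→ℚ-neg (+ zero)    = refl
ℤ→ℚ-neg (+ suc n)   = refl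
ℤ→ℚ-neg ℤ.-[1+ n ] = trans (ℤ→ℚ≡mkℚ (+ suc n)) (cong ℚ.-_ (sym (ℤ→ℚ≡mkℚ ℤ.-[1+ n ])))

ℤ→ℚ-- : ∀ y z → ℤ→ℚ (y ℤ.- z) ≡ ℤ→ℚ y ℚ.- ℤ→ℚ z
ℤ→ℚ-- y z = trans (ℤ→ℚ-+ y (ℤ.- z)) (cong (ℤ→ℚ y ℚ.+_) (ℤ→ℚ-neg z))

ℤ→ℚ-injective : ∀ {y z} → ℤ→ℚ y ≡ ℤ→ℚ z → y ≡ z
ℤ→ℚ-injective {y} {z} eq rewrite ℤ→ℚ≡mkℚ y | ℤ→ℚ≡mkℚ z = cong ℚ.↥_ eq

ℤ→ℚ-isInt : ∀ z → IsInt (ℤ→ℚ z)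
ℤ→ℚ-isInt z rewrite ℤ→ℚ≡mkℚ z = refl

isInt⇒≡ℤ→ℚ : ∀ {q} → IsInt q → q ≡ ℤ→ℚ (ℚ.↥ q)
isInt⇒≡ℤ→ℚ {mkℚ z 0 _} refl = sym (ℤ→ℚ≡mkℚ z)

ℕ→ℚ-nonZero : ∀ N .{{_ : NonZero N}} → ℚ.NonZero (ℕ→ℚ N)
ℕ→ℚ-nonZero (suc n) = subst ℚ.NonZero (sym (ℤ→ℚ≡mkℚ (+ suc n))) _

infix 8 _over_

_over_ : ℤ → (N : ℕ) .{{_ : NonZero N}} → ℚ
z over N = ℤ→ℚ z ℚ.* ℚ.1/_ (ℕ→ℚ N) {{ℕ→ℚ-nonZero N}}

module _ {N : ℕ} .{{_ : NonZero N}} where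

  private
    u = ℚ.1/_ (ℕ→ℚ N) {{ℕ→ℚ-nonZero N}}

    N*u≡1 : ℕ→ℚ N ℚ.* u ≡ ℚ.1ℚ
    N*u≡1 = ℚ.*-inverseʳ (ℕ→ℚ N) {{ℕ→ℚ-nonZero N}}

  ℤ→ℚ-*-over : ∀ y z → ℤ→ℚ y ℚ.* (z over N) ≡ (y ℤ.* z) over N
  ℤ→ℚ-*-over y z = trans (sym (ℚ.*-assoc (ℤ→ℚ y) (ℤ→ℚ z) u)) (cong (ℚ._* u) (sym (ℤ→ℚ-* y z)))

  over-- : ∀ y z → y over N ℚ.- z over N ≡ (y ℤ.- z) over N
  over-- y z = begin
    ℤ→ℚ y ℚ.* u ℚ.- ℤ→ℚ z ℚ.* u        ≡⟨ cong (ℤ→ℚ y ℚ.* u ℚ.+_) (ℚ.neg-distribˡ-* (ℤ→ℚ z) u) ⟩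
    ℤ→ℚ y ℚ.* u ℚ.+ ℚ.- ℤ→ℚ z ℚ.* u    ≡⟨ ℚ.*-distribʳ-+ u (ℤ→ℚ y) (ℚ.- ℤ→ℚ z) ⟨
    (ℤ→ℚ y ℚ.- ℤ→ℚ z) ℚ.* u            ≡⟨ cong (ℚ._* u) (ℤ→ℚ-- y z) ⟨
    ℤ→ℚ (y ℤ.- z) ℚ.* u                ∎
    where open ≡-Reasoning

  N*over : ∀ z → ℕ→ℚ N ℚ.* (z over N) ≡ ℤ→ℚ z
  N*over z = begin
    ℕ→ℚ N ℚ.* (ℤ→ℚ z ℚ.* u)   ≡⟨ ℚ.*-assoc (ℕ→ℚ N) (ℤ→ℚ z) u ⟨
    ℕ→ℚ N ℚ.* ℤ→ℚ z ℚ.* u     ≡⟨ cong (ℚ._* u) (ℚ.*-comm (ℕ→ℚ N) (ℤ→ℚ z)) ⟩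
    ℤ→ℚ z ℚ.* ℕ→ℚ N ℚ.* u     ≡⟨ ℚ.*-assoc (ℤ→ℚ z) (ℕ→ℚ N) u ⟩
    ℤ→ℚ z ℚ.* (ℕ→ℚ N ℚ.* u)   ≡⟨ cong (ℤ→ℚ z ℚ.*_) N*u≡1 ⟩
    ℤ→ℚ z ℚ.* ℚ.1ℚ            ≡⟨ ℚ.*-identityʳ (ℤ→ℚ z) ⟩
    ℤ→ℚ z                     ∎
    where open ≡-Reasoning

  isRootOfUnity⇒≡over : ∀ {q} → IsRootOfUnity N q → q ≡ (ℚ.↥ (ℕ→ℚ N ℚ.* q)) over N
  isRootOfUnity⇒≡over {q} Nq∈ℤ = begin
    q                           ≡⟨ ℚ.*-identityʳ q ⟨
    q ℚ.* ℚ.1ℚ                  ≡⟨ cong (q ℚ.*_) N*u≡1 ⟨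
    q ℚ.* (ℕ→ℚ N ℚ.* u)         ≡⟨ ℚ.*-assoc q (ℕ→ℚ N) u ⟨
    q ℚ.* ℕ→ℚ N ℚ.* u           ≡⟨ cong (ℚ._* u) (ℚ.*-comm q (ℕ→ℚ N)) ⟩
    ℕ→ℚ N ℚ.* q ℚ.* u           ≡⟨ cong (ℚ._* u) (isInt⇒≡ℤ→ℚ {ℕ→ℚ N ℚ.* q} Nq∈ℤ) ⟩
    (ℚ.↥ (ℕ→ℚ N ℚ.* q)) over N  ∎
    where open ≡-Reasoning

  over-isRootOfUnity : ∀ {m z} w → + m ℤ.* z ≡ + N ℤ.* w → IsRootOfUnity m (z over N)
  over-isRootOfUnity {m} {z} w mz≡Nw = subst IsInt (sym m*[z/N]≡w) (ℤ→ℚ-isInt w)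
    where
    m*[z/N]≡w : ℕ→ℚ m ℚ.* (z over N) ≡ ℤ→ℚ w
    m*[z/N]≡w = begin
      ℕ→ℚ m ℚ.* (z over N)         ≡⟨ ℤ→ℚ-*-over (+ m) z ⟩
      (+ m ℤ.* z) over N           ≡⟨ cong (_over N) mz≡Nw ⟩
      (+ N ℤ.* w) over N           ≡⟨ ℤ→ℚ-*-over (+ N) w ⟨
      ℕ→ℚ N ℚ.* (w over N)         ≡⟨ N*over w ⟩
      ℤ→ℚ w                        ∎
      where open ≡-Reasoning

  isRootOfUnity-over⇒∣ : ∀ {m z} → IsRootOfUnity m (z over N) → N ∣ m * ∣ z ∣
  isRootOfUnity-over⇒∣ {m} {z} mz/N∈ℤ = divides ∣ j ∣ (begin
    m * ∣ z ∣            ≡⟨ ℤ.abs-* (+ m) z ⟨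
    ∣ + m ℤ.* z ∣        ≡⟨ cong ∣_∣ (ℤ→ℚ-injective {+ m ℤ.* z} {+ N ℤ.* j} mz≡Nj) ⟩
    ∣ + N ℤ.* j ∣        ≡⟨ ℤ.abs-* (+ N) j ⟩
    N * ∣ j ∣            ≡⟨ ℕ.*-comm N ∣ j ∣ ⟩
    ∣ j ∣ * N            ∎)
    where
    open ≡-Reasoning
    mz/N∈ℤ′ : IsInt ((+ m ℤ.* z) over N)
    mz/N∈ℤ′ = subst IsInt (ℤ→ℚ-*-over (+ m) z) mz/N∈ℤ
    j = ℚ.↥ ((+ m ℤ.* z) over N)
    mz≡Nj : ℤ→ℚ (+ m ℤ.* z) ≡ ℤ→ℚ (+ N ℤ.* j)
    mz≡Nj = begin
      ℤ→ℚ (+ m ℤ.* z)                    ≡⟨ N*over (+ m ℤ.* z) ⟨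
      ℕ→ℚ N ℚ.* ((+ m ℤ.* z) over N)     ≡⟨ cong (ℕ→ℚ N ℚ.*_) (isInt⇒≡ℤ→ℚ mz/N∈ℤ′) ⟩
      ℕ→ℚ N ℚ.* ℤ→ℚ j                    ≡⟨ ℤ→ℚ-* (+ N) j ⟨
      ℤ→ℚ (+ N ℤ.* j)                    ∎

  over-hasOrder : ∀ {c} → Coprime c N → HasOrder₁ ((+ c) over N) N
  over-hasOrder {c} c⊥N = >-nonZero⁻¹ N , over-isRootOfUnity {N} {+ c} (+ c) refl , minimal
    where
    minimal : ∀ m → 1 ≤ m → IsRootOfUnity m ((+ c) over N) → N ≤ m
    minimal m 1≤m mc/N∈ℤ = ∣⇒≤ {{>-nonZero 1≤m}} (coprime-divisor (Coprime-sym c⊥N) N∣cm)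
      where
      N∣cm : N ∣ c * m
      N∣cm = subst (N ∣_) (ℕ.*-comm m c) (isRootOfUnity-over⇒∣ {m} {+ c} mc/N∈ℤ)

≈μ-split : ∀ x y → x ≈μ ((x ℚ.- y) ·μ y)
≈μ-split x y = subst IsInt (sym x-[[x-y]+y]≡0) refl
  where
  open ≡-Reasoning
  x-[[x-y]+y]≡0 : x ℚ.- ((x ℚ.- y) ℚ.+ y) ≡ ℚ.0ℚ
  x-[[x-y]+y]≡0 = begin
    x ℚ.- ((x ℚ.- y) ℚ.+ y)     ≡⟨ cong (λ q → x ℚ.- q) (ℚ.+-assoc x (ℚ.- y) y) ⟩
    x ℚ.- (x ℚ.+ (ℚ.- y ℚ.+ y)) ≡⟨ cong (λ q → x ℚ.- (x ℚ.+ q)) (ℚ.+-inverseˡ y) ⟩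
    x ℚ.- (x ℚ.+ ℚ.0ℚ)          ≡⟨ cong (λ q → x ℚ.- q) (ℚ.+-identityʳ x) ⟩
    x ℚ.- x                     ≡⟨ ℚ.+-inverseʳ x ⟩
    ℚ.0ℚ                        ∎

-- Rescaling by gcd(D, N)

rescaled-residue : ∀ g d M a k m → (g ℤ.* d) ℤ.* a ≡ k ℤ.+ (g ℤ.* M) ℤ.* m → g ℤ.* (d ℤ.* a ℤ.- M ℤ.* m) ≡ k
rescaled-residue g d M a k m gda≡k+gMm = begin
  g ℤ.* (d ℤ.* a ℤ.- M ℤ.* m)                   ≡⟨ ℤ-Solver.solve (g ∷ d ∷ M ∷ a ∷ m ∷ []) ⟩
  (g ℤ.* d) ℤ.* a ℤ.- (g ℤ.* M) ℤ.* m           ≡⟨ cong (λ z → z ℤ.- (g ℤ.* M) ℤ.* m) gda≡k+gMm ⟩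
  k ℤ.+ (g ℤ.* M) ℤ.* m ℤ.- (g ℤ.* M) ℤ.* m     ≡⟨ ℤ-Solver.solve (k ∷ g ∷ M ∷ m ∷ []) ⟩
  k                                             ∎
  where open ≡-Reasoning

rescaled-root : ∀ g d M c S a m → c ℤ.* d ≡ 1ℤ ℤ.+ M ℤ.* S →
  g ℤ.* (a ℤ.- (d ℤ.* a ℤ.- M ℤ.* m) ℤ.* c) ≡ (g ℤ.* M) ℤ.* (m ℤ.* c ℤ.- a ℤ.* S)
rescaled-root g d M c S a m cd≡1+MS = begin
  g ℤ.* (a ℤ.- (d ℤ.* a ℤ.- M ℤ.* m) ℤ.* c)
    ≡⟨ ℤ-Solver.solve (g ∷ d ∷ M ∷ c ∷ a ∷ m ∷ []) ⟩
  g ℤ.* a ℤ.- g ℤ.* a ℤ.* (c ℤ.* d) ℤ.+ (g ℤ.* M) ℤ.* (m ℤ.* c)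
    ≡⟨ cong (λ z → g ℤ.* a ℤ.- g ℤ.* a ℤ.* z ℤ.+ (g ℤ.* M) ℤ.* (m ℤ.* c)) cd≡1+MS ⟩
  g ℤ.* a ℤ.- g ℤ.* a ℤ.* (1ℤ ℤ.+ M ℤ.* S) ℤ.+ (g ℤ.* M) ℤ.* (m ℤ.* c)
    ≡⟨ ℤ-Solver.solve (g ∷ M ∷ c ∷ S ∷ a ∷ m ∷ []) ⟩
  (g ℤ.* M) ℤ.* (m ℤ.* c ℤ.- a ℤ.* S) ∎
  where open ≡-Reasoning

record Cofactors (D N g : ℕ) : Set where
  field
    d M     : ℕ
    D≡d*g   : D ≡ d * g
    N≡M*g   : N ≡ M * g
    inverse : UnitInverse d M N

gcd-cofactors : ∀ D N .{{_ : NonZero N}} → Cofactors D N (gcd D N)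
gcd-cofactors D N = record
  { d       = quotient g∣D
  ; M       = quotient g∣N
  ; D≡d*g   = m∣n⇒n≡quotient*m g∣D
  ; N≡M*g   = m∣n⇒n≡quotient*m g∣N
  ; inverse = unit-inverse N {{quotient≢0 g∣N}} d⊥M
  }
  where
  g∣D = gcd[m,n]∣m D N
  g∣N = gcd[m,n]∣n D N
  d⊥M : Coprime (quotient g∣D) (quotient g∣N)
  d⊥M = Bézout-coprime {{≢-nonZero (gcd[m,n]≢0 D N (inj₂ (≢-nonZero⁻¹ N)))}}
    (subst₂ (Bézout.Identity (gcd D N)) (m∣n⇒n≡quotient*m g∣D) (m∣n⇒n≡quotient*m g∣N) (Bézout.identity (gcd-GCD D N)))

decomposition : ∀ {n Small} (a : Fin n → ℤ) {N D g} .{{_ : NonZero N}} → Cofactors D N g →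
  (A : Approximation N a D Small) → Σ ℚ λ ζN → Σ (Fin n → ℤ) λ k →
    HasOrder₁ ζN N × (∀ i → g * ∣ k i ∣ ≡ ∣ Approximation.residue A i ∣) ×
    (∀ i → IsRootOfUnity g (a i over N ℚ.- ζN ^μ k i))
decomposition {n} a {N} {D} {g} C A = (+ c) over N , k , over-hasOrder c⊥N , scale , root
  where
  open Cofactors C
  open UnitInverse inverse
  open Approximation A
  +≡g*+ : ∀ {X} Y → X ≡ Y * g → + X ≡ + g ℤ.* + Y
  +≡g*+ {X} Y X≡Yg = trans (cong +_ (trans X≡Yg (ℕ.*-comm Y g))) (ℤ.pos-* g Y)
  k : Fin n → ℤ
  k i = + d ℤ.* a i ℤ.- + M ℤ.* multiple i
  gk≡residue : ∀ i → + g ℤ.* k i ≡ residue i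
  gk≡residue i = rescaled-residue (+ g) (+ d) (+ M) (a i) (residue i) (multiple i)
    (subst₂ (λ X Y → X ℤ.* a i ≡ residue i ℤ.+ Y ℤ.* multiple i) (+≡g*+ d D≡d*g) (+≡g*+ M N≡M*g) (equation i))
  scale : ∀ i → g * ∣ k i ∣ ≡ ∣ residue i ∣
  scale i = trans (sym (ℤ.abs-* (+ g) (k i))) (cong ∣_∣ (gk≡residue i))
  root : ∀ i → IsRootOfUnity g (a i over N ℚ.- ((+ c) over N) ^μ k i)
  root i = subst (IsRootOfUnity g) [a-kc]/N≡ζ (over-isRootOfUnity {m = g} {z = a i ℤ.- k i ℤ.* + c} w g[a-kc]≡Nw)
    where
    w = multiple i ℤ.* + c ℤ.- a i ℤ.* S
    g[a-kc]≡Nw : + g ℤ.* (a i ℤ.- k i ℤ.* + c) ≡ + N ℤ.* w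
    g[a-kc]≡Nw = trans (rescaled-root (+ g) (+ d) (+ M) (+ c) S (a i) (multiple i) cd≡1+MS)
                       (cong (ℤ._* w) (sym (+≡g*+ M N≡M*g)))
    [a-kc]/N≡ζ : (a i ℤ.- k i ℤ.* + c) over N ≡ a i over N ℚ.- ((+ c) over N) ^μ k i
    [a-kc]/N≡ζ = trans (sym (over-- (a i) (k i ℤ.* + c))) (cong (λ z → a i over N ℚ.- z) (sym (ℤ→ℚ-*-over (k i) (+ c))))

lemma3 : (n : ℕ) → 1 ≤ n → (x : Fin n → ℚ) → (N : ℕ) → HasOrder x N →
    Σ ℕ λ e → Σ ℚ λ ζN → Σ (Fin n → ℚ) λ ζe → Σ (Fin n → ℤ) λ k →
      1 ≤ e × ≤Bound n N e × e ∣ N × HasOrder₁ ζN N ×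
      (∀ i → IsRootOfUnity e (ζe i)) ×
      (∀ i → ≤Bound n N (e * ∣ k i ∣)) ×
      (∀ i → x i ≈μ (ζe i ·μ (ζN ^μ k i)))
lemma3 (suc n) _ x N (1≤N , N-kills-x , _) = case approximation a N of λ
  { (D , 1≤D , D-bound , A) → case decomposition a (gcd-cofactors D N) A of λ
    { (ζN , k , ζN-order , scale , root) →
      gcd D N , ζN , (λ i → x i ℚ.- ζN ^μ k i) , k ,
      ℕ.n≢0⇒n>0 (gcd[m,n]≢0 D N (inj₂ (≢-nonZero⁻¹ N))) ,
      ≤Bound-mono (suc n) N (∣⇒≤ {{>-nonZero 1≤D}} (gcd[m,n]∣m D N)) D-bound ,
      gcd[m,n]∣n D N ,
      ζN-order ,
      (λ i → subst (λ y → IsRootOfUnity (gcd D N) (y ℚ.- ζN ^μ k i)) (sym (x≡a/N i)) (root i)) ,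
      (λ i → subst (≤Bound (suc n) N) (sym (scale i)) (Approximation.small A i)) ,
      (λ i → ≈μ-split (x i) (ζN ^μ k i)) } }
  where
  instance
    N≢0 : NonZero N
    N≢0 = >-nonZero 1≤N
  a : Fin (suc n) → ℤ
  a i = ℚ.↥ (ℕ→ℚ N ℚ.* x i)
  x≡a/N : ∀ i → x i ≡ a i over N
  x≡a/N i = isRootOfUnity⇒≡over {N} {x i} (N-kills-x i)
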